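{- Let $\Pi$ be a projective plane of even order $q$, and let $\mathcal{O}_1,\mathcal{O}_2$ be two hyperovals in $\Pi$ having exactly two common points $P$ and $Q$. Let $\mathrm{S}(\mathcal{O}_i)$ denote the set of secant lines of $\mathcal{O}_i$ and $\mathscr{P}(P)$ the set of lines through $P$. Then $$\#\big(\mathrm{S}(\mathcal{O}_1)\setminus\mathscr{P}(P)\big)=\frac{q(q+1)}{2}\quad\text{and}\quad \#\big((\mathrm{S}(\mathcal{O}_1)\cap\mathrm{S}(\mathcal{O}_2))\setminus\mathscr{P}(P)\big)=\frac{q^2}{4}+\frac{q}{2}.$$
   Context: A hyperoval in a projective plane of order $q$ is a set of $q+2$ points no three of which are collinear; every line meets it in $0$ or $2$ points, and lines meeting it in $2$ points are called secant lines. -}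

module Defs where

open import Data.Nat using (ℕ; zero; suc; _+_; _*_; _≡ᵇ_)
open import Data.Nat.Divisibility using (_∣_)
open import Data.Fin using (Fin; zero; suc)
open import Data.Bool using (Bool; true; false; T; if_then_else_; _∧_; not)
open import Data.Product using (Σ; _×_; ∃-syntax)
open import Relation.Binary.PropositionalEquality using (_≡_; _≢_)
open import Relation.Nullary using (¬_)

count : {n : ℕ} → (Fin n → Bool) → ℕ
count {zero}  f = 0
count {suc n} f = (if f zero then 1 else 0) + count (λ i → f (suc i))

numPts : ℕ → ℕ
numPts q = q * q + q + 1

Point : ℕ → Set
Point q = Fin (numPts q)

Line : ℕ → Set
Line q = Fin (numPts q)

record ProjectivePlane (q : ℕ) : Set where
  field
    inc : Point q → Line q → Bool
    joinExists : ∀ (p r : Point q) → p ≢ r → ∃[ l ] (T (inc p l) × T (inc r l))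
    joinUnique : ∀ (p r : Point q) (l m : Line q) → p ≢ r →
                 T (inc p l) → T (inc r l) → T (inc p m) → T (inc r m) → l ≡ m
    meetExists : ∀ (l m : Line q) → l ≢ m → ∃[ p ] (T (inc p l) × T (inc p m))
    meetUnique : ∀ (l m : Line q) (p r : Point q) → l ≢ m →
                 T (inc p l) → T (inc p m) → T (inc r l) → T (inc r m) → p ≡ r
    quadrangle : Σ (Fin 4 → Point q) λ f →
                 ∀ (i j k : Fin 4) → i ≢ j → i ≢ k → j ≢ k →
                 ¬ (∃[ l ] (T (inc (f i) l) × T (inc (f j) l) × T (inc (f k) l)))
    order : ∀ (l : Line q) → count (λ p → inc p l) ≡ q + 1

open ProjectivePlane public

PointSet : ℕ → Set
PointSet q = Point q → Bool

Collinear3 : {q : ℕ} → ProjectivePlane q → Point q → Point q → Point q → Set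
Collinear3 Π a b c = ∃[ l ] (T (inc Π a l) × T (inc Π b l) × T (inc Π c l))

IsHyperoval : {q : ℕ} → ProjectivePlane q → PointSet q → Set
IsHyperoval {q} Π O =
  (count O ≡ q + 2) ×
  (∀ a b c → T (O a) → T (O b) → T (O c) → a ≢ b → a ≢ c → b ≢ c →
     ¬ Collinear3 Π a b c)

isSecant : {q : ℕ} → ProjectivePlane q → PointSet q → Line q → Bool
isSecant Π O l = count (λ p → O p ∧ inc Π p l) ≡ᵇ 2

through : {q : ℕ} → ProjectivePlane q → Point q → Line q → Bool
through Π P l = inc Π P l

Even : ℕ → Set
Even q = 2 ∣ q

module Submission where

-- A point of a plane of order q lies on q + 1 lines; for x on a hyperoval O these lines share the
-- other q + 1 points of O, at most one each, so every line meets O in 0 or 2 points and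
-- |O ∩ l| = 2·[l secant to O].  Summing |O₁ ∩ l| over the lines l missing P and exchanging the sums
-- counts, for each x ∈ O₁ ∖ {P}, the q lines through x that miss P; so twice the number of these
-- secants is q (q + 1).  Weighting those lines by |O₂ ∩ l| instead, they carry |O₂| + q [x ∈ O₂] − 2
-- points of O₂ (the line xP is secant to O₂), so four times the number of common secants missing P
-- is q (q + |O₁ ∩ O₂|) = q (q + 2).

open import Defs
open import Data.Bool using (Bool; true; false; T; _∧_; not; if_then_else_)
open import Data.Bool.Properties using (∧-identityʳ; ∧-zeroʳ; T-∧; T-≡)
open import Data.Empty using (⊥-elim)
open import Data.Fin using (Fin; zero; suc; _≟_)
import Data.Fin.Properties as Fin
open import Data.Nat using (ℕ; zero; suc; _+_; _*_; _≤_; _<_; z≤n; s≤s; s≤s⁻¹; NonZero; _≡ᵇ_; _/_)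
open import Data.Nat.Properties
  using ( +-*-semiring; +-assoc; +-comm; +-identityʳ; +-cancelˡ-≡; +-cancelʳ-≡; +-mono-≤; +-monoʳ-≤
        ; +-cancelʳ-≤; *-assoc; *-comm; *-identityˡ; *-identityʳ; *-zeroʳ; *-distribˡ-+; *-cancelˡ-≡
        ; *-monoʳ-≤; ≤-antisym; ≤-trans; ≤-reflexive; ≮⇒≥)
open import Algebra.Properties.Semiring.Sum +-*-semiring
  using (sum; sum-cong-≗; sum-replicate-zero; ∑-distrib-+; ∑-comm; *-distribˡ-sum; *-distribʳ-sum)
open import Data.Nat.Tactic.RingSolver using (solve-∀)
open import Data.Nat.Divisibility using (divides)
open import Data.Nat.DivMod using (m*n/n≡m)
open import Data.Product using (_×_; _,_; proj₁; proj₂; ∃-syntax; uncurry)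
open import Data.Sum using (_⊎_; inj₁; inj₂)
open import Function using (_∘_; Equivalence)
open import Relation.Binary.PropositionalEquality
  using (_≡_; _≢_; refl; sym; trans; cong; cong₂; subst; module ≡-Reasoning)
open import Relation.Nullary using (¬_; yes; no; does)

private variable n : ℕ

𝟙 : Bool → ℕ
𝟙 b = if b then 1 else 0

𝟙-T : ∀ {b} → T b → 𝟙 b ≡ 1
𝟙-T {true} _ = refl

𝟙-∧ : ∀ a b → 𝟙 (a ∧ b) ≡ 𝟙 a * 𝟙 b
𝟙-∧ false b = refl
𝟙-∧ true  b = sym (+-identityʳ (𝟙 b))

𝟙-idem : ∀ b → 𝟙 b * 𝟙 b ≡ 𝟙 b
𝟙-idem false = refl
𝟙-idem true  = refl

sum-ones : ∀ n → sum {n} (λ _ → 1) ≡ n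
sum-ones zero    = refl
sum-ones (suc n) = cong suc (sum-ones n)

sum-update : {f g : Fin n → ℕ} (a : Fin n) → (∀ i → i ≢ a → f i ≡ g i) →
             sum f + g a ≡ sum g + f a
sum-update {suc n} {f} {g} zero f≗g = begin
  f zero + sum (λ i → f (suc i)) + g zero
    ≡⟨ cong (λ s → f zero + s + g zero) (sum-cong-≗ λ i → f≗g (suc i) λ ()) ⟩
  f zero + sum (λ i → g (suc i)) + g zero
    ≡⟨ swap-outer (f zero) _ (g zero) ⟩
  g zero + sum (λ i → g (suc i)) + f zero ∎
  where
  open ≡-Reasoning
  swap-outer : ∀ a s b → a + s + b ≡ b + s + a
  swap-outer = solve-∀
sum-update {suc n} {f} {g} (suc a) f≗g = begin
  f zero + sum (λ i → f (suc i)) + g (suc a)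
    ≡⟨ +-assoc (f zero) _ _ ⟩
  f zero + (sum (λ i → f (suc i)) + g (suc a))
    ≡⟨ cong₂ _+_ (f≗g zero λ ()) (sum-update a λ i i≢a → f≗g (suc i) (i≢a ∘ Fin.suc-injective)) ⟩
  g zero + (sum (λ i → g (suc i)) + f (suc a))
    ≡⟨ +-assoc (g zero) _ _ ⟨
  g zero + sum (λ i → g (suc i)) + f (suc a) ∎
  where open ≡-Reasoning

sum-supported-at : {f : Fin n → ℕ} (a : Fin n) → (∀ i → i ≢ a → f i ≡ 0) → sum f ≡ f a
sum-supported-at {n} {f} a f≗0 = +-cancelʳ-≡ 0 _ _ (begin
  sum f + 0                ≡⟨ sum-update a f≗0 ⟩
  sum {n} (λ _ → 0) + f a  ≡⟨ cong (_+ f a) (sum-replicate-zero n) ⟩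
  f a                      ≡⟨ +-identityʳ (f a) ⟨
  f a + 0                  ∎)
  where open ≡-Reasoning

sum-𝟙-update : (S : Fin n → Bool) {h g : Fin n → ℕ} {a : Fin n} → T (S a) → h a ≡ 0 →
               (∀ i → i ≢ a → h i ≡ g i) →
               sum (λ i → 𝟙 (S i) * h i) + g a ≡ sum (λ i → 𝟙 (S i) * g i)
sum-𝟙-update S {h} {g} {a} Sa ha≡0 h≗g = begin
  sum (λ i → 𝟙 (S i) * h i) + g a
    ≡⟨ cong (_ +_) (trans (cong (_* g a) (𝟙-T Sa)) (*-identityˡ (g a))) ⟨
  sum (λ i → 𝟙 (S i) * h i) + 𝟙 (S a) * g a
    ≡⟨ sum-update a (λ i i≢a → cong (𝟙 (S i) *_) (h≗g i i≢a)) ⟩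
  sum (λ i → 𝟙 (S i) * g i) + 𝟙 (S a) * h a
    ≡⟨ cong (λ c → _ + 𝟙 (S a) * c) ha≡0 ⟩
  sum (λ i → 𝟙 (S i) * g i) + 𝟙 (S a) * 0
    ≡⟨ cong (sum (λ i → 𝟙 (S i) * g i) +_) (*-zeroʳ (𝟙 (S a))) ⟩
  sum (λ i → 𝟙 (S i) * g i) + 0
    ≡⟨ +-identityʳ _ ⟩
  sum (λ i → 𝟙 (S i) * g i) ∎
  where open ≡-Reasoning

sum-mono-≤ : {f g : Fin n → ℕ} → (∀ i → f i ≤ g i) → sum f ≤ sum g
sum-mono-≤ {zero}  _   = z≤n
sum-mono-≤ {suc n} f≤g = +-mono-≤ (f≤g zero) (sum-mono-≤ (λ i → f≤g (suc i)))

sum-≤-≡⇒≡ : {f g : Fin n → ℕ} → (∀ i → f i ≤ g i) → sum f ≡ sum g → ∀ i → f i ≡ g i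
sum-≤-≡⇒≡ {suc n} {f} {g} f≤g Σf≡Σg = at
  where
  tail≤ : sum (λ i → f (suc i)) ≤ sum (λ i → g (suc i))
  tail≤ = sum-mono-≤ (λ i → f≤g (suc i))
  head≡ : f zero ≡ g zero
  head≡ = ≤-antisym (f≤g zero) (+-cancelʳ-≤ _ _ _
    (≤-trans (≤-reflexive (sym Σf≡Σg)) (+-monoʳ-≤ (f zero) tail≤)))
  tail≡ : sum (λ i → f (suc i)) ≡ sum (λ i → g (suc i))
  tail≡ = +-cancelˡ-≡ (f zero) _ _ (trans Σf≡Σg (cong (_+ _) (sym head≡)))
  at : ∀ i → f i ≡ g i
  at zero    = head≡
  at (suc i) = sum-≤-≡⇒≡ (λ j → f≤g (suc j)) tail≡ i

count-sum : (f : Fin n → Bool) → count f ≡ sum (λ i → 𝟙 (f i))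
count-sum {zero}  f = refl
count-sum {suc n} f = cong (𝟙 (f zero) +_) (count-sum (λ i → f (suc i)))

_∖_ : (Fin n → Bool) → Fin n → (Fin n → Bool)
(f ∖ a) i = f i ∧ not (does (i ≟ a))

∖-sound : (f : Fin n → Bool) {a i : Fin n} → T ((f ∖ a) i) → T (f i) × i ≢ a
∖-sound f {a} {i} fi with i ≟ a
... | yes _   = ⊥-elim (proj₂ (Equivalence.to T-∧ fi))
... | no i≢a = proj₁ (Equivalence.to T-∧ fi) , i≢a

∖-self : (f : Fin n → Bool) (a : Fin n) → (f ∖ a) a ≡ false
∖-self f a with a ≟ a
... | yes _   = ∧-zeroʳ (f a)
... | no a≢a = ⊥-elim (a≢a refl)

∖-other : (f : Fin n → Bool) {a i : Fin n} → i ≢ a → (f ∖ a) i ≡ f i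
∖-other f {a} {i} i≢a with i ≟ a
... | yes i≡a = ⊥-elim (i≢a i≡a)
... | no _    = ∧-identityʳ (f i)

count-∖ : (f : Fin n → Bool) {a : Fin n} → T (f a) → count f ≡ suc (count (f ∖ a))
count-∖ f {a} fa = begin
  count f                             ≡⟨ +-identityʳ (count f) ⟨
  count f + 0                         ≡⟨ cong (count f +_) (cong 𝟙 (∖-self f a)) ⟨
  count f + 𝟙 ((f ∖ a) a)             ≡⟨ cong₂ _+_ (count-sum f) refl ⟩
  sum (λ i → 𝟙 (f i)) + 𝟙 ((f ∖ a) a) ≡⟨ sum-update a (λ i i≢a → cong 𝟙 (sym (∖-other f i≢a))) ⟩
  sum (λ i → 𝟙 ((f ∖ a) i)) + 𝟙 (f a) ≡⟨ cong₂ _+_ (sym (count-sum (f ∖ a))) (𝟙-T fa) ⟩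
  count (f ∖ a) + 1                   ≡⟨ +-comm (count (f ∖ a)) 1 ⟩
  suc (count (f ∖ a))                 ∎
  where open ≡-Reasoning

count>0⇒∃ : (f : Fin n → Bool) → 0 < count f → ∃[ i ] T (f i)
count>0⇒∃ {suc n} f 0<count with f zero in f0
... | true  = zero , Equivalence.from T-≡ f0
... | false with count>0⇒∃ (f ∘ suc) 0<count
...   | i , fi = suc i , fi

count-none : (f : Fin n → Bool) → (∀ i → ¬ T (f i)) → count f ≡ 0
count-none {zero}  f _     = refl
count-none {suc n} f empty with f zero in f0
... | true  = ⊥-elim (empty zero (Equivalence.from T-≡ f0))
... | false = count-none (f ∘ suc) (empty ∘ suc)

count>k⇒∃∖ : (f : Fin n → Bool) {k : ℕ} → suc k ≤ count f → ∃[ a ] (T (f a) × k ≤ count (f ∖ a))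
count>k⇒∃∖ f k<count with a , fa ← count>0⇒∃ f (≤-trans (s≤s z≤n) k<count) =
  a , fa , s≤s⁻¹ (subst (_ ≤_) (count-∖ f fa) k<count)

count≥3⇒distinct : (f : Fin n → Bool) → 3 ≤ count f →
  ∃[ a ] ∃[ b ] ∃[ c ] (T (f a) × T (f b) × T (f c) × a ≢ b × a ≢ c × b ≢ c)
count≥3⇒distinct f 3≤count
  with a , fa  , 2≤ ← count>k⇒∃∖ f 3≤count
  with b , fb′ , 1≤ ← count>k⇒∃∖ (f ∖ a) 2≤
  with c , fc″ , _  ← count>k⇒∃∖ ((f ∖ a) ∖ b) 1≤
  with fb , b≢a ← ∖-sound f fb′
  with fc′ , c≢b ← ∖-sound (f ∖ a) fc″
  with fc , c≢a ← ∖-sound f fc′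
  = a , b , c , fa , fb , fc , b≢a ∘ sym , c≢a ∘ sym , c≢b ∘ sym

count-pair : (f : Fin n → Bool) {a b : Fin n} → a ≢ b → T (f a) → T (f b) →
             (∀ i → T (f i) → i ≡ a ⊎ i ≡ b) → count f ≡ 2
count-pair f {a} {b} a≢b fa fb only = begin
  count f                   ≡⟨ count-∖ f fa ⟩
  suc (count (f ∖ a))       ≡⟨ cong suc (count-∖ (f ∖ a) (subst T (sym (∖-other f (a≢b ∘ sym))) fb)) ⟩
  2 + count ((f ∖ a) ∖ b)   ≡⟨ cong (2 +_) (count-none ((f ∖ a) ∖ b) outside) ⟩
  2                         ∎
  where
  open ≡-Reasoning
  outside : ∀ i → ¬ T (((f ∖ a) ∖ b) i)
  outside i fi with f∖a-i , i≢b ← ∖-sound (f ∖ a) fi with fi , i≢a ← ∖-sound f f∖a-i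
    with only i fi
  ... | inj₁ i≡a = i≢a i≡a
  ... | inj₂ i≡b = i≢b i≡b

-- In order 0 the only line contains the only point, so the quadrangle would be collinear.
order-nonZero : {q : ℕ} → ProjectivePlane q → NonZero q
order-nonZero {suc q} Π = _
order-nonZero {zero}  Π with inc Π zero zero in p∈l | order Π zero | quadrangle Π
... | false | () | _
... | true  | _  | f , noncollinear = ⊥-elim
  (noncollinear zero (suc zero) (suc (suc zero)) (λ ()) (λ ()) (λ ())
    (zero , on-line (f zero) , on-line (f (suc zero)) , on-line (f (suc (suc zero)))))
  where
  on-line : (p : Point 0) → T (inc Π p zero)
  on-line zero = Equivalence.from T-≡ p∈l

module _ {q : ℕ} (Π : ProjectivePlane q) where

  I : Point q → Line q → ℕ
  I p l = 𝟙 (inc Π p l)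

  pencilSum : Point q → (Line q → ℕ) → ℕ
  pencilSum x w = sum (λ l → I x l * w l)

  join : (x y : Point q) → x ≢ y → Line q
  join x y x≢y = proj₁ (joinExists Π x y x≢y)

  join-right : ∀ {x y} (x≢y : x ≢ y) → T (inc Π y (join x y x≢y))
  join-right {x} {y} x≢y = proj₂ (proj₂ (joinExists Π x y x≢y))

  pencilSum-join : ∀ {x y} (x≢y : x ≢ y) (w : Line q → ℕ) →
                   pencilSum x (λ l → I y l * w l) ≡ w (join x y x≢y)
  pencilSum-join {x} {y} x≢y w with l₀ , x∈l₀ , y∈l₀ ← joinExists Π x y x≢y =
    trans (sum-supported-at l₀ off-join) on-join
    where
    off-join : ∀ l → l ≢ l₀ → I x l * (I y l * w l) ≡ 0
    off-join l l≢l₀ with inc Π x l in x∈l | inc Π y l in y∈l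
    ... | false | _     = refl
    ... | true  | false = refl
    ... | true  | true  = ⊥-elim (l≢l₀ (joinUnique Π x y l l₀ x≢y
                            (Equivalence.from T-≡ x∈l) (Equivalence.from T-≡ y∈l) x∈l₀ y∈l₀))
    on-join : I x l₀ * (I y l₀ * w l₀) ≡ w l₀
    on-join = trans (cong₂ (λ a b → a * (b * w l₀)) (𝟙-T x∈l₀) (𝟙-T y∈l₀))
                    (trans (*-identityˡ _) (*-identityˡ (w l₀)))

  double-count : (u : Point q → ℕ) (w : Line q → ℕ) →
                 sum (λ l → sum (λ p → u p * I p l) * w l) ≡ sum (λ p → u p * pencilSum p w)
  double-count u w = begin
    sum (λ l → sum (λ p → u p * I p l) * w l)
      ≡⟨ sum-cong-≗ (λ l → *-distribʳ-sum (w l) (λ p → u p * I p l)) ⟩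
    sum (λ l → sum (λ p → u p * I p l * w l))
      ≡⟨ ∑-comm (λ l p → u p * I p l * w l) ⟩
    sum (λ p → sum (λ l → u p * I p l * w l))
      ≡⟨ sum-cong-≗ (λ p → sum-cong-≗ (λ l → *-assoc (u p) (I p l) (w l))) ⟩
    sum (λ p → sum (λ l → u p * (I p l * w l)))
      ≡⟨ sum-cong-≗ (λ p → *-distribˡ-sum (u p) (λ l → I p l * w l)) ⟨
    sum (λ p → u p * pencilSum p w) ∎
    where open ≡-Reasoning

  pencilSum-incidence : ∀ {p x} → p ≢ x → pencilSum p (I x) ≡ 1
  pencilSum-incidence {p} {x} p≢x =
    trans (sum-cong-≗ (λ l → cong (I p l *_) (sym (*-identityʳ (I x l)))))
          (pencilSum-join p≢x (λ _ → 1))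

  pencilSum-self : ∀ x → pencilSum x (I x) ≡ count (inc Π x)
  pencilSum-self x = trans (sum-cong-≗ (λ l → 𝟙-idem (inc Π x l))) (sym (count-sum (inc Π x)))

  -- Count the incident pairs (p, l) with x on l: each of the d lines through x has q + 1 points,
  -- and every p ≢ x lies on exactly one of them, so (q + 1) d = (q² + q) + d.
  point-degree : ∀ x → count (inc Π x) ≡ q + 1
  point-degree x = *-cancelˡ-≡ d (q + 1) q {{order-nonZero Π}}
    (+-cancelʳ-≡ (1 * d + 1) _ _ (trans (expand-lhs q d) (trans incidences (expand-rhs q d))))
    where
    d = count (inc Π x)
    G : Point q → ℕ
    G p = 1 * pencilSum p (I x)
    open ≡-Reasoning
    incidences : (q + 1) * d + 1 ≡ numPts q + 1 * d
    incidences = begin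
      (q + 1) * d + 1
        ≡⟨ cong (λ s → (q + 1) * s + 1) (count-sum (inc Π x)) ⟩
      (q + 1) * sum (λ l → I x l) + 1
        ≡⟨ cong (_+ 1) (*-distribˡ-sum (q + 1) (I x)) ⟩
      sum (λ l → (q + 1) * I x l) + 1
        ≡⟨ cong (_+ 1) (sum-cong-≗ (λ l → cong (_* I x l) line-size)) ⟨
      sum (λ l → sum (λ p → 1 * I p l) * I x l) + 1
        ≡⟨ cong (_+ 1) (double-count (λ _ → 1) (I x)) ⟩
      sum G + 1
        ≡⟨ sum-update x (λ p p≢x → trans (*-identityˡ _) (pencilSum-incidence p≢x)) ⟩
      sum {numPts q} (λ _ → 1) + G x
        ≡⟨ cong₂ _+_ (sum-ones (numPts q)) (cong (1 *_) (pencilSum-self x)) ⟩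
      numPts q + 1 * d ∎
      where
      line-size : ∀ {l} → sum (λ p → 1 * I p l) ≡ q + 1
      line-size {l} = trans (sum-cong-≗ (λ p → *-identityˡ (I p l)))
                            (trans (sym (count-sum (λ p → inc Π p l))) (order Π l))
    expand-lhs : ∀ q d → q * d + (1 * d + 1) ≡ (q + 1) * d + 1
    expand-lhs = solve-∀
    expand-rhs : ∀ q d → q * q + q + 1 + 1 * d ≡ q * (q + 1) + (1 * d + 1)
    expand-rhs = solve-∀

  meet : PointSet q → Line q → ℕ
  meet S l = count (λ p → S p ∧ inc Π p l)

  meet-sum : ∀ S l → meet S l ≡ sum (λ p → 𝟙 (S p) * I p l)
  meet-sum S l = trans (count-sum (λ p → S p ∧ inc Π p l)) (sum-cong-≗ (λ p → 𝟙-∧ (S p) (inc Π p l)))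

  pencilSum-meet : ∀ S x → pencilSum x (meet S) ≡ count S + q * 𝟙 (S x)
  pencilSum-meet S x = +-cancelʳ-≡ (𝟙 (S x)) _ _ (begin
    pencilSum x (meet S) + 𝟙 (S x)
      ≡⟨ cong (_+ 𝟙 (S x)) (sum-cong-≗ λ l →
         trans (*-comm (I x l) _) (cong (_* I x l) (meet-sum S l))) ⟩
    sum (λ l → sum (λ p → 𝟙 (S p) * I p l) * I x l) + 𝟙 (S x)
      ≡⟨ cong (_+ 𝟙 (S x)) (double-count (λ p → 𝟙 (S p)) (I x)) ⟩
    sum (λ p → 𝟙 (S p) * pencilSum p (I x)) + 𝟙 (S x)
      ≡⟨ sum-update x (λ p p≢x →
         trans (cong (𝟙 (S p) *_) (pencilSum-incidence p≢x)) (*-identityʳ _)) ⟩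
    sum (λ p → 𝟙 (S p)) + 𝟙 (S x) * pencilSum x (I x)
      ≡⟨ cong₂ _+_ (sym (count-sum S))
         (cong (𝟙 (S x) *_) (trans (pencilSum-self x) (point-degree x))) ⟩
    count S + 𝟙 (S x) * (q + 1)
      ≡⟨ rearrange (count S) (𝟙 (S x)) q ⟩
    count S + q * 𝟙 (S x) + 𝟙 (S x) ∎)
    where
    open ≡-Reasoning
    rearrange : ∀ c b q → c + b * (q + 1) ≡ c + q * b + b
    rearrange = solve-∀

  module _ {O : PointSet q} (hyperoval : IsHyperoval Π O) where

    meet-≤2 : ∀ l → meet O l ≤ 2
    meet-≤2 l = ≮⇒≥ λ 2<meet →
      let a , b , c , a∈ , b∈ , c∈ , a≢b , a≢c , b≢c = count≥3⇒distinct (λ p → O p ∧ inc Π p l) 2<meet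
          Oa , a∈l = Equivalence.to T-∧ a∈
          Ob , b∈l = Equivalence.to T-∧ b∈
          Oc , c∈l = Equivalence.to T-∧ c∈
      in proj₂ hyperoval a b c Oa Ob Oc a≢b a≢c b≢c (l , a∈l , b∈l , c∈l)

    meet-through : ∀ {x l} → T (O x) → T (inc Π x l) → meet O l ≡ 2
    meet-through {x} {l} Ox x∈l = *-cancelˡ-≡ (meet O l) 2 1
      (subst (λ i → i * meet O l ≡ i * 2) (𝟙-T x∈l)
        (sum-≤-≡⇒≡ (λ l → *-monoʳ-≤ (I x l) (meet-≤2 l)) pencil-total l))
      where
      open ≡-Reasoning
      pencil-total : pencilSum x (meet O) ≡ sum (λ l → I x l * 2)
      pencil-total = begin
        pencilSum x (meet O)      ≡⟨ pencilSum-meet O x ⟩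
        count O + q * 𝟙 (O x)     ≡⟨ cong₂ (λ c b → c + q * b) (proj₁ hyperoval) (𝟙-T Ox) ⟩
        q + 2 + q * 1             ≡⟨ double q ⟩
        (q + 1) * 2               ≡⟨ cong (_* 2) (trans (sym (point-degree x)) (count-sum (inc Π x))) ⟩
        sum (λ l → I x l) * 2     ≡⟨ *-distribʳ-sum 2 (I x) ⟩
        sum (λ l → I x l * 2)     ∎
        where
        double : ∀ q → q + 2 + q * 1 ≡ (q + 1) * 2
        double = solve-∀

    meet-secant : ∀ l → meet O l ≡ 2 * 𝟙 (isSecant Π O l)
    meet-secant l = empty-or-two (meet O l) λ 0<meet →
      let p , p∈ = count>0⇒∃ (λ p → O p ∧ inc Π p l) 0<meet
      in uncurry meet-through (Equivalence.to T-∧ p∈)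
      where
      empty-or-two : ∀ m → (0 < m → m ≡ 2) → m ≡ 2 * 𝟙 (m ≡ᵇ 2)
      empty-or-two zero    _        = refl
      empty-or-two (suc m) nonempty with refl ← nonempty (s≤s z≤n) = refl

    secant-weight : ∀ l v → 2 * (𝟙 (isSecant Π O l) * v) ≡ meet O l * v
    secant-weight l v = trans (sym (*-assoc 2 (𝟙 (isSecant Π O l)) v)) (cong (_* v) (sym (meet-secant l)))

  avoiding : Point q → (Line q → ℕ) → Point q → ℕ
  avoiding P w x = pencilSum x (λ l → w l * 𝟙 (not (inc Π P l)))

  avoiding-self : ∀ P w → avoiding P w P ≡ 0
  avoiding-self P w = trans (sum-cong-≗ term≡0) (sum-replicate-zero (numPts q))
    where
    term≡0 : ∀ l → I P l * (w l * 𝟙 (not (inc Π P l))) ≡ 0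
    term≡0 l with inc Π P l
    ... | false = refl
    ... | true  = trans (+-identityʳ _) (*-zeroʳ (w l))

  avoiding-other : ∀ {x P} (x≢P : x ≢ P) w → avoiding P w x + w (join x P x≢P) ≡ pencilSum x w
  avoiding-other {x} {P} x≢P w = begin
    avoiding P w x + w (join x P x≢P)
      ≡⟨ cong (avoiding P w x +_) (pencilSum-join x≢P w) ⟨
    avoiding P w x + pencilSum x (λ l → I P l * w l)
      ≡⟨ ∑-distrib-+ (λ l → I x l * (w l * 𝟙 (np l))) (λ l → I x l * (I P l * w l)) ⟨
    sum (λ l → I x l * (w l * 𝟙 (np l)) + I x l * (I P l * w l))
      ≡⟨ sum-cong-≗ (λ l → trans (sym (*-distribˡ-+ (I x l) _ _)) (cong (I x l *_) (split (inc Π P l) (w l)))) ⟩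
    pencilSum x w ∎
    where
    open ≡-Reasoning
    np : Line q → Bool
    np l = not (inc Π P l)
    split : ∀ b m → m * 𝟙 (not b) + 𝟙 b * m ≡ m
    split false m = trans (+-identityʳ _) (*-identityʳ m)
    split true  m = trans (cong (_+ (m + 0)) (*-zeroʳ m)) (+-identityʳ m)

  meet-avoiding : ∀ S P w →
    sum (λ l → meet S l * (w l * 𝟙 (not (inc Π P l)))) ≡ sum (λ x → 𝟙 (S x) * avoiding P w x)
  meet-avoiding S P w = trans (sum-cong-≗ (λ l → cong (_* _) (meet-sum S l)))
                              (double-count (λ x → 𝟙 (S x)) (λ l → w l * 𝟙 (not (inc Π P l))))

  avoiding-one : ∀ {x P} → x ≢ P → avoiding P (λ _ → 1) x ≡ q
  avoiding-one {x} {P} x≢P = +-cancelʳ-≡ 1 _ _ (begin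
    avoiding P (λ _ → 1) x + 1  ≡⟨ avoiding-other x≢P (λ _ → 1) ⟩
    sum (λ l → I x l * 1)       ≡⟨ sum-cong-≗ (λ l → *-identityʳ (I x l)) ⟩
    sum (λ l → I x l)           ≡⟨ trans (sym (count-sum (inc Π x))) (point-degree x) ⟩
    q + 1                       ∎)
    where open ≡-Reasoning

  avoiding-meet : ∀ {O x P} → IsHyperoval Π O → T (O P) → x ≢ P → avoiding P (meet O) x ≡ q + q * 𝟙 (O x)
  avoiding-meet {O} {x} {P} hyperoval OP x≢P = +-cancelʳ-≡ 2 _ _ (begin
    avoiding P (meet O) x + 2
      ≡⟨ cong (_ +_) (meet-through hyperoval OP (join-right x≢P)) ⟨
    avoiding P (meet O) x + meet O (join x P x≢P)
      ≡⟨ avoiding-other x≢P (meet O) ⟩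
    pencilSum x (meet O)
      ≡⟨ pencilSum-meet O x ⟩
    count O + q * 𝟙 (O x)
      ≡⟨ cong (_+ q * 𝟙 (O x)) (proj₁ hyperoval) ⟩
    q + 2 + q * 𝟙 (O x)
      ≡⟨ swap-last q 2 (q * 𝟙 (O x)) ⟩
    q + q * 𝟙 (O x) + 2 ∎)
    where
    open ≡-Reasoning
    swap-last : ∀ a b c → a + b + c ≡ a + c + b
    swap-last = solve-∀

  secants-avoiding : ∀ {O P} → IsHyperoval Π O → T (O P) →
                     2 * count (λ l → isSecant Π O l ∧ not (through Π P l)) ≡ q * (q + 1)
  secants-avoiding {O} {P} hyperoval OP = +-cancelʳ-≡ q _ _ (begin
    2 * count (λ l → s l ∧ np l) + q
      ≡⟨ cong (λ c → 2 * c + q) (count-sum (λ l → s l ∧ np l)) ⟩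
    2 * sum (λ l → 𝟙 (s l ∧ np l)) + q
      ≡⟨ cong (_+ q) (*-distribˡ-sum 2 (λ l → 𝟙 (s l ∧ np l))) ⟩
    sum (λ l → 2 * 𝟙 (s l ∧ np l)) + q
      ≡⟨ cong (_+ q) (sum-cong-≗ weigh) ⟩
    sum (λ l → meet O l * (1 * 𝟙 (np l))) + q
      ≡⟨ cong (_+ q) (meet-avoiding O P (λ _ → 1)) ⟩
    sum (λ x → 𝟙 (O x) * avoiding P (λ _ → 1) x) + q
      ≡⟨ sum-𝟙-update O OP (avoiding-self P (λ _ → 1))
         (λ x x≢P → avoiding-one x≢P) ⟩
    sum (λ x → 𝟙 (O x) * q)
      ≡⟨ *-distribʳ-sum q (λ x → 𝟙 (O x)) ⟨
    sum (λ x → 𝟙 (O x)) * q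
      ≡⟨ cong (_* q) (trans (sym (count-sum O)) (proj₁ hyperoval)) ⟩
    (q + 2) * q
      ≡⟨ expand q ⟩
    q * (q + 1) + q ∎)
    where
    open ≡-Reasoning
    s np : Line q → Bool
    s = isSecant Π O
    np l = not (inc Π P l)
    weigh : ∀ l → 2 * 𝟙 (s l ∧ np l) ≡ meet O l * (1 * 𝟙 (np l))
    weigh l = begin
      2 * 𝟙 (s l ∧ np l)            ≡⟨ cong (2 *_) (𝟙-∧ (s l) (np l)) ⟩
      2 * (𝟙 (s l) * 𝟙 (np l))      ≡⟨ secant-weight hyperoval l _ ⟩
      meet O l * 𝟙 (np l)           ≡⟨ cong (meet O l *_) (*-identityˡ (𝟙 (np l))) ⟨
      meet O l * (1 * 𝟙 (np l))     ∎
    expand : ∀ q → (q + 2) * q ≡ q * (q + 1) + q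
    expand = solve-∀

  common-secants-avoiding : ∀ {O₁ O₂ P} → IsHyperoval Π O₁ → IsHyperoval Π O₂ → T (O₁ P) → T (O₂ P) →
    4 * count (λ l → (isSecant Π O₁ l ∧ isSecant Π O₂ l) ∧ not (through Π P l))
      ≡ q * (q + count (λ x → O₁ x ∧ O₂ x))
  common-secants-avoiding {O₁} {O₂} {P} hyperoval₁ hyperoval₂ O₁P O₂P = +-cancelʳ-≡ (q + q * 1) _ _ (begin
    4 * count (λ l → s₁₂ l ∧ np l) + (q + q * 1)
      ≡⟨ cong (λ c → 4 * c + _) (count-sum (λ l → s₁₂ l ∧ np l)) ⟩
    4 * sum (λ l → 𝟙 (s₁₂ l ∧ np l)) + (q + q * 1)
      ≡⟨ cong (_+ _) (*-distribˡ-sum 4 (λ l → 𝟙 (s₁₂ l ∧ np l))) ⟩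
    sum (λ l → 4 * 𝟙 (s₁₂ l ∧ np l)) + (q + q * 1)
      ≡⟨ cong (_+ _) (sum-cong-≗ weigh) ⟩
    sum (λ l → meet O₁ l * (meet O₂ l * 𝟙 (np l))) + (q + q * 1)
      ≡⟨ cong (_+ _) (meet-avoiding O₁ P (meet O₂)) ⟩
    sum (λ x → 𝟙 (O₁ x) * avoiding P (meet O₂) x) + (q + q * 1)
      ≡⟨ cong (λ b → sum (λ x → 𝟙 (O₁ x) * avoiding P (meet O₂) x) + (q + q * b)) (𝟙-T O₂P) ⟨
    sum (λ x → 𝟙 (O₁ x) * avoiding P (meet O₂) x) + (q + q * 𝟙 (O₂ P))
      ≡⟨ sum-𝟙-update O₁ O₁P (avoiding-self P (meet O₂)) (λ x x≢P → avoiding-meet hyperoval₂ O₂P x≢P) ⟩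
    sum (λ x → 𝟙 (O₁ x) * (q + q * 𝟙 (O₂ x)))
      ≡⟨ sum-cong-≗ (λ x → distribute (O₁ x) (O₂ x)) ⟩
    sum (λ x → q * 𝟙 (O₁ x) + q * 𝟙 (O₁ x ∧ O₂ x))
      ≡⟨ ∑-distrib-+ (λ x → q * 𝟙 (O₁ x)) (λ x → q * 𝟙 (O₁ x ∧ O₂ x)) ⟩
    sum (λ x → q * 𝟙 (O₁ x)) + sum (λ x → q * 𝟙 (O₁ x ∧ O₂ x))
      ≡⟨ cong₂ _+_ (*-distribˡ-sum q (λ x → 𝟙 (O₁ x))) (*-distribˡ-sum q (λ x → 𝟙 (O₁ x ∧ O₂ x))) ⟨
    q * sum (λ x → 𝟙 (O₁ x)) + q * sum (λ x → 𝟙 (O₁ x ∧ O₂ x))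
      ≡⟨ cong₂ (λ a b → q * a + q * b) (trans (sym (count-sum O₁)) (proj₁ hyperoval₁))
                                         (sym (count-sum (λ x → O₁ x ∧ O₂ x))) ⟩
    q * (q + 2) + q * k
      ≡⟨ expand q k ⟩
    q * (q + k) + (q + q * 1) ∎)
    where
    open ≡-Reasoning
    s₁₂ np : Line q → Bool
    s₁₂ l = isSecant Π O₁ l ∧ isSecant Π O₂ l
    np l = not (inc Π P l)
    k = count (λ x → O₁ x ∧ O₂ x)
    weigh : ∀ l → 4 * 𝟙 (s₁₂ l ∧ np l) ≡ meet O₁ l * (meet O₂ l * 𝟙 (np l))
    weigh l = begin
      4 * 𝟙 (s₁₂ l ∧ np l)
        ≡⟨ cong (4 *_) (trans (𝟙-∧ (s₁₂ l) (np l)) (cong (_* _) (𝟙-∧ (isSecant Π O₁ l) _))) ⟩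
      4 * (𝟙 (isSecant Π O₁ l) * 𝟙 (isSecant Π O₂ l) * 𝟙 (np l))
        ≡⟨ reassoc (𝟙 (isSecant Π O₁ l)) _ _ ⟩
      2 * (𝟙 (isSecant Π O₁ l) * (2 * (𝟙 (isSecant Π O₂ l) * 𝟙 (np l))))
        ≡⟨ secant-weight hyperoval₁ l _ ⟩
      meet O₁ l * (2 * (𝟙 (isSecant Π O₂ l) * 𝟙 (np l)))
        ≡⟨ cong (meet O₁ l *_) (secant-weight hyperoval₂ l _) ⟩
      meet O₁ l * (meet O₂ l * 𝟙 (np l)) ∎
      where
      reassoc : ∀ a b c → 4 * (a * b * c) ≡ 2 * (a * (2 * (b * c)))
      reassoc = solve-∀
    distribute : ∀ a b → 𝟙 a * (q + q * 𝟙 b) ≡ q * 𝟙 a + q * 𝟙 (a ∧ b)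
    distribute a b = trans (distrib q (𝟙 a) (𝟙 b)) (cong (λ c → q * 𝟙 a + q * c) (sym (𝟙-∧ a b)))
      where
      distrib : ∀ q a b → a * (q + q * b) ≡ q * a + q * (a * b)
      distrib = solve-∀
    expand : ∀ q k → q * (q + 2) + q * k ≡ q * (q + k) + (q + q * 1)
    expand = solve-∀

2*n≡m⇒n≡m/2 : ∀ {n m} → 2 * n ≡ m → n ≡ m / 2
2*n≡m⇒n≡m/2 {n} refl = sym (trans (cong (_/ 2) (*-comm 2 n)) (m*n/n≡m n 2))

4*n≡q*[q+2]⇒n≡q*q/4+q/2 : ∀ {n q} → Even q → 4 * n ≡ q * (q + 2) → n ≡ q * q / 4 + q / 2
4*n≡q*[q+2]⇒n≡q*q/4+q/2 {n} (divides m refl) 4n≡ = begin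
  n                                ≡⟨ *-cancelˡ-≡ n (m * m + m) 4 (trans 4n≡ (quarter m)) ⟩
  m * m + m                        ≡⟨ cong₂ _+_ (m*n/n≡m (m * m) 4) (m*n/n≡m m 2) ⟨
  m * m * 4 / 4 + m * 2 / 2        ≡⟨ cong (λ x → x / 4 + m * 2 / 2) (square m) ⟩
  m * 2 * (m * 2) / 4 + m * 2 / 2  ∎
  where
  open ≡-Reasoning
  quarter : ∀ m → m * 2 * (m * 2 + 2) ≡ 4 * (m * m + m)
  quarter = solve-∀
  square : ∀ m → m * m * 4 ≡ m * 2 * (m * 2)
  square = solve-∀

lemma5p1 : ∀ (q : ℕ) (Π : ProjectivePlane q) → Even q →
    ∀ (O₁ O₂ : PointSet q) → IsHyperoval Π O₁ → IsHyperoval Π O₂ →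
    ∀ (P Q : Point q) → P ≢ Q →
    T (O₁ P) → T (O₂ P) → T (O₁ Q) → T (O₂ Q) →
    (∀ x → T (O₁ x) → T (O₂ x) → (x ≡ P) ⊎ (x ≡ Q)) →
    (count (λ l → isSecant Π O₁ l ∧ not (through Π P l)) ≡ (q * (q + 1)) / 2)
    × (count (λ l → (isSecant Π O₁ l ∧ isSecant Π O₂ l) ∧ not (through Π P l))
        ≡ (q * q) / 4 + q / 2)
lemma5p1 q Π even O₁ O₂ hyperoval₁ hyperoval₂ P Q P≢Q O₁P O₂P O₁Q O₂Q common =
  2*n≡m⇒n≡m/2 (secants-avoiding Π hyperoval₁ O₁P) ,
  4*n≡q*[q+2]⇒n≡q*q/4+q/2 even (trans (common-secants-avoiding Π hyperoval₁ hyperoval₂ O₁P O₂P)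
                          (cong (λ k → q * (q + k)) two-common-points))
  where
  two-common-points : count (λ x → O₁ x ∧ O₂ x) ≡ 2
  two-common-points = count-pair (λ x → O₁ x ∧ O₂ x) P≢Q
    (Equivalence.from T-∧ (O₁P , O₂P)) (Equivalence.from T-∧ (O₁Q , O₂Q))
    (λ x x∈ → uncurry (common x) (Equivalence.to T-∧ x∈))
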